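{- For any integer $r\ge 2$, $$\chi_l(K_{(r+1)*r}^r)>\chi(K_{(r+1)*r}^r)=r.$$
   Context: All hypergraphs are finite. A vertex coloring of a hypergraph is proper if no edge is monochromatic. $\chi(H)$ is the chromatic number. A $k$-list assignment $L$ assigns to each vertex $v$ a set $L(v)$ of exactly $k$ colors; an $L$-coloring is a proper coloring with each vertex $v$ colored from $L(v)$; $\chi_l(H)$ is the least $k$ such that $H$ is $L$-colorable for every $k$-list assignment $L$. For positive integers $p_1,\dots,p_k$ and disjoint sets $V_1,\dots,V_k$ with $|V_i|=p_i$, the hypergraph $K^r_{p_1,\dots,p_k}$ has vertex set $V_1\cup\cdots\cup V_k$ and edge set consisting of all $r$-subsets $S$ of the vertex set with $S\not\subseteq V_i$ for every $i$. $K^r_{(r+1)*r}$ denotes this hypergraph with $r$ parts, each of size $r+1$. -}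

module Defs where

open import Data.Nat using (ℕ; _<_; _*_; suc)
open import Data.Fin using (Fin; quotient)
open import Data.Fin.Subset using (Subset; _∈_; ∣_∣)
open import Data.List using (List; length)
open import Data.List.Relation.Unary.Unique.Propositional using (Unique)
import Data.List.Membership.Propositional as LM
open import Data.Product using (Σ; ∃; _×_; proj₁)
open import Relation.Binary.PropositionalEquality using (_≡_; _≢_)
open import Relation.Nullary using (¬_)

record Hypergraph : Set₁ where
  field
    n    : ℕ
    Edge : Subset n → Set
open Hypergraph public

Proper : (H : Hypergraph) {C : Set} → (Fin (n H) → C) → Set
Proper H c = ∀ (S : Subset (n H)) → Edge H S →
  Σ (Fin (n H)) λ u → Σ (Fin (n H)) λ v → u ∈ S × v ∈ S × c u ≢ c v

Colorable : Hypergraph → ℕ → Set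
Colorable H k = Σ (Fin (n H) → Fin k) λ c → Proper H c

IsChromaticNumber : Hypergraph → ℕ → Set
IsChromaticNumber H k = Colorable H k × (∀ j → j < k → ¬ Colorable H j)

ListAssignment : Hypergraph → ℕ → Set
ListAssignment H k = Σ (Fin (n H) → List ℕ) λ L →
  ∀ v → length (L v) ≡ k × Unique (L v)

LColorable : (H : Hypergraph) {k : ℕ} → ListAssignment H k → Set
LColorable H L = Σ (Fin (n H) → ℕ) λ c → (∀ v → c v LM.∈ proj₁ L v) × Proper H c

Choosable : Hypergraph → ℕ → Set
Choosable H k = ∀ (L : ListAssignment H k) → LColorable H L

IsListChromaticNumber : Hypergraph → ℕ → Set
IsListChromaticNumber H k = Choosable H k × (∀ j → j < k → ¬ Choosable H j)

-- K^r_{p*k}: k parts, each of size p.  Vertices are Fin (k * p); vertex v lies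
-- in part  quotient p v : Fin k  (blocks of p consecutive vertices).
CompleteMultipartite : (r k p : ℕ) → Hypergraph
CompleteMultipartite r k p = record
  { n    = k * p
  ; Edge = λ S → ∣ S ∣ ≡ r ×
      ¬ (Σ (Fin k) λ i → ∀ v → v ∈ S → quotient p v ≡ i)
  }

K[r+1*r] : ℕ → Hypergraph
K[r+1*r] r = CompleteMultipartite r r (suc r)

-- Colouring by parts gives χ ≤ r. A colour class meeting two parts has fewer than r vertices, for
-- otherwise r of its vertices, two of them in different parts, would form a monochromatic edge; so
-- every class has at most r + 1 vertices, and the r(r + 1) vertices need r colours.
-- Now let the list of the j-th vertex of a part be {0, …, r} ∖ {j}. The class of colour x inside
-- part i misses the vertex in slot x, so all classes have at most r vertices; r + 1 colours then
-- cover the r(r + 1) vertices only if every class has exactly r vertices and lies inside one part.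
-- But in a part, the classes of its vertex in slot 0 and of its vertex in slot c(slot 0) are
-- disjoint, giving 2r ≤ r + 1. So χ_l > r. That χ_l exists at all needs choosability to be
-- decidable: up to an injective relabelling of colours, a list assignment uses a bounded palette.
module Submission where

open import Defs
open import Data.Nat as ℕ using (ℕ; zero; suc; _+_; _*_; _≤_; _<_; z≤n; s≤s; s≤s⁻¹)
open import Data.Nat.Properties
open import Data.Nat.Induction using (<-rec)
open import Data.Fin as Fin
  using (Fin; zero; suc; toℕ; fromℕ; fromℕ<; inject₁; cast; _↑ˡ_; _↑ʳ_; combine; quotient; remainder; punchIn)
import Data.Fin.Properties as Finₚ
open import Data.Fin.Subset using (Subset; _∈_; ∣_∣; inside; outside)
open import Data.Fin.Subset.Properties using (_∈?_; anySubset?; nonempty?; Empty-unique; ∣⊥∣≡0)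
open import Data.Vec as Vec using (Vec; []; _∷_; here; there; lookup; tabulate; toList; fromList)
import Data.Vec.Properties as Vecₚ
open import Data.List as List using (List; []; _∷_; length; map; take; _++_)
import Data.List.Properties as Listₚ
open import Data.List.Relation.Unary.Any as Any using (here; there; index)
open import Data.List.Relation.Unary.Any.Properties using (lookup-index)
open import Data.List.Relation.Unary.All as All using (All)
import Data.List.Relation.Unary.All.Properties as Allₚ
open import Data.List.Relation.Unary.AllPairs using ([]; _∷_)
open import Data.List.Relation.Unary.Unique.Propositional using (Unique)
import Data.List.Relation.Unary.Unique.Propositional.Properties as Uniqueₚ
import Data.List.Relation.Unary.Unique.DecPropositional as UniqueDec
open import Data.List.Membership.Propositional using (find; lose) renaming (_∈_ to _∈ₗ_; _∉_ to _∉ₗ_)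
import Data.List.Membership.Propositional.Properties as Memₚ
import Data.List.Membership.DecPropositional as MemDec
open import Data.List.Relation.Binary.Sublist.Propositional.Properties using (Any-resp-⊆; take-⊆)
open import Data.Product using (Σ; ∃; _×_; _,_; proj₁; proj₂)
open import Data.Sum using (_⊎_; inj₁; inj₂)
open import Data.Empty using (⊥)
open import Function using (_∘_; _$_; id)
open import Level using (0ℓ)
open import Relation.Binary.Definitions using (DecidableEquality)
open import Relation.Binary.PropositionalEquality
  using (_≡_; _≢_; refl; sym; trans; cong; cong₂; subst; subst-injective; module ≡-Reasoning)
open import Relation.Nullary using (Dec; yes; no; ¬_; ¬?; contradiction)
open import Relation.Nullary.Decidable using (map′; _×-dec_; _→-dec_; _⊎-dec_; decidable-stable)
open import Relation.Unary using (Pred; Decidable)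
open import Algebra.Properties.Semiring.Sum +-*-semiring
  using (sum; sum-syntax; sum-cong-≗; ∑-distrib-+; ∑-comm; *-distribˡ-sum)

sum-mono-≤ : ∀ {n} {f g : Fin n → ℕ} → (∀ i → f i ≤ g i) → sum f ≤ sum g
sum-mono-≤ {zero}  f≤g = z≤n
sum-mono-≤ {suc n} f≤g = +-mono-≤ (f≤g zero) (sum-mono-≤ (f≤g ∘ suc))

sum-mono-< : ∀ {n} {f g : Fin n → ℕ} {j} → (∀ i → f i ≤ g i) → f j < g j → sum f < sum g
sum-mono-< {j = zero}  f≤g fj<gj = +-mono-<-≤ fj<gj (sum-mono-≤ (f≤g ∘ suc))
sum-mono-< {j = suc j} f≤g fj<gj = +-mono-≤-< (f≤g zero) (sum-mono-< (f≤g ∘ suc) fj<gj)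

sum-const : ∀ n c → sum {n} (λ _ → c) ≡ n * c
sum-const zero    c = refl
sum-const (suc n) c = cong (c +_) (sum-const n c)

sum-splitAt : ∀ m {n} (f : Fin (m + n) → ℕ) → sum f ≡ sum (f ∘ (_↑ˡ n)) + sum (f ∘ (m ↑ʳ_))
sum-splitAt zero    f = refl
sum-splitAt (suc m) f = trans (cong (f zero +_) (sum-splitAt m (f ∘ suc))) (sym (+-assoc (f zero) _ _))

sum-combine : ∀ m {n} (f : Fin (m * n) → ℕ) → sum f ≡ ∑[ i < m ] ∑[ j < n ] f (combine i j)
sum-combine zero        f = refl
sum-combine (suc m) {n} f =
  trans (sum-splitAt n f) (cong (sum (f ∘ (_↑ˡ m * n)) +_) (sum-combine m (f ∘ (n ↑ʳ_))))

indicator : ∀ {P : Set} → Dec P → ℕ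
indicator (yes _) = 1
indicator (no _)  = 0

count : ∀ {n} {P : Pred (Fin n) 0ℓ} → Decidable P → ℕ
count P? = sum (λ v → indicator (P? v))

module _ {n} {P Q : Pred (Fin n) 0ℓ} (P? : Decidable P) (Q? : Decidable Q) where

  count-mono : (∀ {v} → P v → Q v) → count P? ≤ count Q?
  count-mono P⊆Q = sum-mono-≤ pointwise
    where
    pointwise : ∀ v → indicator (P? v) ≤ indicator (Q? v)
    pointwise v with P? v | Q? v
    ... | yes p | yes _ = ≤-refl
    ... | yes p | no ¬q = contradiction (P⊆Q p) ¬q
    ... | no _  | _     = z≤n

  count-⊎-≤ : {R : Pred (Fin n) 0ℓ} (R? : Decidable R) → (∀ {v} → R v → P v ⊎ Q v) →
              count R? ≤ count P? + count Q?
  count-⊎-≤ R? R⊆P∪Q =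
    ≤-trans (sum-mono-≤ pointwise) (≤-reflexive (∑-distrib-+ (indicator ∘ P?) (indicator ∘ Q?)))
    where
    pointwise : ∀ v → indicator (R? v) ≤ indicator (P? v) + indicator (Q? v)
    pointwise v with R? v | P? v | Q? v
    ... | no _  | _     | _     = z≤n
    ... | yes _ | yes _ | _     = s≤s z≤n
    ... | yes _ | no _  | yes _ = s≤s z≤n
    ... | yes r | no ¬p | no ¬q with R⊆P∪Q r
    ...   | inj₁ p = contradiction p ¬p
    ...   | inj₂ q = contradiction q ¬q

  count-disjoint-≤ : {R : Pred (Fin n) 0ℓ} (R? : Decidable R) →
                     (∀ {v} → P v → ¬ Q v) → (∀ {v} → P v ⊎ Q v → R v) → count P? + count Q? ≤ count R?
  count-disjoint-≤ R? P∩Q=∅ P∪Q⊆R =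
    ≤-trans (≤-reflexive (sym (∑-distrib-+ (indicator ∘ P?) (indicator ∘ Q?)))) (sum-mono-≤ pointwise)
    where
    pointwise : ∀ v → indicator (P? v) + indicator (Q? v) ≤ indicator (R? v)
    pointwise v with P? v | Q? v | R? v
    ... | no _  | no _  | _     = z≤n
    ... | yes p | yes q | _     = contradiction q (P∩Q=∅ p)
    ... | yes _ | no _  | yes _ = ≤-refl
    ... | no _  | yes _ | yes _ = ≤-refl
    ... | yes p | no _  | no ¬r = contradiction (P∪Q⊆R (inj₁ p)) ¬r
    ... | no _  | yes q | no ¬r = contradiction (P∪Q⊆R (inj₂ q)) ¬r

count-cong : ∀ {n} {P Q : Pred (Fin n) 0ℓ} (P? : Decidable P) (Q? : Decidable Q) →
             (∀ {v} → P v → Q v) → (∀ {v} → Q v → P v) → count P? ≡ count Q?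
count-cong P? Q? P⊆Q Q⊆P = ≤-antisym (count-mono P? Q? P⊆Q) (count-mono Q? P? Q⊆P)

count-empty : ∀ {n} {P : Pred (Fin n) 0ℓ} (P? : Decidable P) → (∀ v → ¬ P v) → count P? ≡ 0
count-empty {zero}  P? ∅ = refl
count-empty {suc n} P? ∅ with P? zero
... | yes p = contradiction p (∅ zero)
... | no _  = count-empty (P? ∘ suc) (∅ ∘ suc)

count-singleton : ∀ {n} (w : Fin n) → count (Fin._≟ w) ≡ 1
count-singleton {suc n} zero    = cong suc (count-empty (λ (v : Fin n) → suc v Fin.≟ zero) λ _ ())
count-singleton {suc n} (suc w) = trans (count-cong (λ v → suc v Fin.≟ suc w) (Fin._≟ w) Finₚ.suc-injective (cong suc))
                                        (count-singleton w)

count-singletonˡ : ∀ {n} (w : Fin n) → count (w Fin.≟_) ≡ 1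
count-singletonˡ w = trans (count-cong (w Fin.≟_) (Fin._≟ w) sym sym) (count-singleton w)

count-pair-≤ : ∀ {n} (a b : Fin n) → count (λ v → (v Fin.≟ a) ⊎-dec (v Fin.≟ b)) ≤ 2
count-pair-≤ a b = ≤-trans (count-⊎-≤ (Fin._≟ a) (Fin._≟ b) _ id)
                           (≤-reflexive (cong₂ _+_ (count-singleton a) (count-singleton b)))

∑-count-fibres : ∀ {n m} (c : Fin n → Fin m) → ∑[ x < m ] count (λ v → c v Fin.≟ x) ≡ n
∑-count-fibres {n} {m} c = begin
  ∑[ x < m ] ∑[ v < n ] indicator (c v Fin.≟ x) ≡⟨ ∑-comm (λ x v → indicator (c v Fin.≟ x)) ⟩
  ∑[ v < n ] count (c v Fin.≟_)                 ≡⟨ sum-cong-≗ (λ v → count-singletonˡ (c v)) ⟩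
  ∑[ v < n ] 1                                  ≡⟨ sum-const n 1 ⟩
  n * 1                                         ≡⟨ *-identityʳ n ⟩
  n                                             ∎
  where open ≡-Reasoning

Between : ∀ {n} → Pred (Fin n) 0ℓ → Pred (Fin n) 0ℓ → ℕ → Set
Between {n} A P t = ∃ λ (S : Subset n) → (∀ {v} → A v → v ∈ S) × (∀ {v} → v ∈ S → P v) × ∣ S ∣ ≡ t

module _ {n : ℕ} {A P : Pred (Fin (suc n)) 0ℓ} {t : ℕ} where

  between-inside : P zero → Between (A ∘ suc) (P ∘ suc) t → Between A P (suc t)
  between-inside p (S , A⊆S , S⊆P , ∣S∣≡t) =
    inside ∷ S , (λ { {zero} _ → here ; {suc _} a → there (A⊆S a) })
               , (λ { here → p ; (there v∈S) → S⊆P v∈S }) , cong suc ∣S∣≡t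

  between-outside : ¬ A zero → Between (A ∘ suc) (P ∘ suc) t → Between A P t
  between-outside ¬a (S , A⊆S , S⊆P , ∣S∣≡t) =
    outside ∷ S , (λ { {zero} a → contradiction a ¬a ; {suc _} a → there (A⊆S a) })
                , (λ { (there v∈S) → S⊆P v∈S }) , ∣S∣≡t

subset-between : ∀ {n} {A P : Pred (Fin n) 0ℓ} (A? : Decidable A) (P? : Decidable P) {t} →
  (∀ {v} → A v → P v) → count A? ≤ t → t ≤ count P? → Between A P t
subset-between {zero} A? P? A⊆P _ z≤n = [] , (λ { {()} }) , (λ { {()} }) , refl
subset-between {suc n} A? P? {t} A⊆P A≤t t≤P with A? zero | P? zero
... | yes a | no ¬p = contradiction (A⊆P a) ¬p
... | yes a | yes p with t | A≤t
...   | suc t′ | s≤s A≤t′ = between-inside p (subset-between (A? ∘ suc) (P? ∘ suc) A⊆P A≤t′ (s≤s⁻¹ t≤P))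
subset-between {suc n} A? P? {t} A⊆P A≤t t≤P | no ¬a | no ¬p =
  between-outside ¬a (subset-between (A? ∘ suc) (P? ∘ suc) A⊆P A≤t t≤P)
subset-between {suc n} A? P? {t} A⊆P A≤t t≤P | no ¬a | yes p with t ≤? count (P? ∘ suc)
... | yes t≤P′ = between-outside ¬a (subset-between (A? ∘ suc) (P? ∘ suc) A⊆P A≤t t≤P′)
... | no t≰P′ = subst (Between _ _) (≤-antisym (≰⇒> t≰P′) t≤P) (between-inside p
      (subset-between (A? ∘ suc) (P? ∘ suc) A⊆P (count-mono (A? ∘ suc) (P? ∘ suc) A⊆P) ≤-refl))

Searchable : Set → Set₁
Searchable A = ∀ {P : Pred A 0ℓ} → Decidable P → Dec (∃ P)

searchable-Vec : ∀ {A} → Searchable A → ∀ {n} → Searchable (Vec A n)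
searchable-Vec search {zero}  P? = map′ ([] ,_) (λ { ([] , p) → p }) (P? [])
searchable-Vec search {suc n} P? =
  map′ (λ { (a , w , p) → a ∷ w , p }) (λ { (a ∷ w , p) → a , w , p })
       (search (λ a → searchable-Vec search (P? ∘ (a ∷_))))

search-∀ : ∀ {A} → Searchable A → ∀ {P : Pred A 0ℓ} → Decidable P → Dec (∀ a → P a)
search-∀ search P? with search (¬? ∘ P?)
... | yes (a , ¬pa) = no λ all → ¬pa (all a)
... | no none      = yes λ a → decidable-stable (P? a) (λ ¬pa → none (a , ¬pa))

least : ∀ {P : Pred ℕ 0ℓ} → Decidable P → ∀ {m} → P m → ∃ λ l → P l × (∀ j → j < l → ¬ P j)
least {P} P? {m} = <-rec (λ m → P m → Least) step m
  where
  Least = ∃ λ l → P l × (∀ j → j < l → ¬ P j)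
  step : ∀ m → (∀ {j} → j < m → P j → Least) → P m → Least
  step m smaller pm with anyUpTo? P? m
  ... | yes (j , j<m , pj) = smaller j<m pj
  ... | no none           = m , pm , λ j j<m pj → none (j , j<m , pj)

module _ {A : Set} (_≟_ : DecidableEquality A) where
  open MemDec _≟_ using () renaming (_∈?_ to _∈ₗ?_)

  ∈-─ : ∀ {x z : A} {ys} (x∈ys : x ∈ₗ ys) → z ∈ₗ ys → z ≢ x → z ∈ₗ (ys Any.─ x∈ys)
  ∈-─ (here refl) (here refl) z≢x = contradiction refl z≢x
  ∈-─ (here _)    (there z∈ys) _  = z∈ys
  ∈-─ (there _)   (here z≡y) _    = here z≡y
  ∈-─ (there x∈ys) (there z∈ys) z≢x = there (∈-─ x∈ys z∈ys z≢x)

  unique⇒length≤ : ∀ {xs ys : List A} → Unique xs → (∀ {z} → z ∈ₗ xs → z ∈ₗ ys) → length xs ≤ length ys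
  unique⇒length≤ {[]} _ _ = z≤n
  unique⇒length≤ {x ∷ xs} {ys} (x∉xs ∷ unique) xs⊆ys =
    subst (suc (length xs) ≤_) (sym (Listₚ.length-removeAt′ ys (index x∈ys)))
      (s≤s (unique⇒length≤ unique λ z∈xs →
        ∈-─ x∈ys (xs⊆ys (there z∈xs)) (λ z≡x → All.lookup x∉xs z∈xs (sym z≡x))))
    where
    x∈ys = xs⊆ys (here refl)

  fresh : ∀ {xs ys : List A} → Unique xs → length ys < length xs → ∃ λ z → z ∈ₗ xs × z ∉ₗ ys
  fresh {xs} {ys} unique ys<xs with Any.any? (λ z → ¬? (z ∈ₗ? ys)) xs
  ... | yes some = find some
  ... | no none  = contradiction (unique⇒length≤ unique xs⊆ys) (<⇒≱ ys<xs)
    where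
    xs⊆ys : ∀ {z} → z ∈ₗ xs → z ∈ₗ ys
    xs⊆ys {z} z∈xs = decidable-stable (z ∈ₗ? ys) (λ z∉ys → none (lose z∈xs z∉ys))

  distinct-representatives : ∀ {m} (L : Fin m → List A) → (∀ v → m ≤ length (L v)) → (∀ v → Unique (L v)) →
    ∃ λ (c : Fin m → A) → (∀ v → c v ∈ₗ L v) × (∀ {u v} → c u ≡ c v → u ≡ v)
  distinct-representatives {zero}  L _ _ = (λ ()) , (λ ()) , λ { {()} }
  distinct-representatives {suc m} L long unique
    with c , c∈L , c-inj ← distinct-representatives (L ∘ suc) (λ v → ≤-trans (n≤1+n m) (long (suc v))) (unique ∘ suc)
    with z , z∈L₀ , z-new ← fresh {ys = List.tabulate c} (unique zero)
           (subst (_< length (L zero)) (sym (Listₚ.length-tabulate c)) (long zero))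
    = c′ , c′∈L , λ {u} {v} → c′-inj u v
    where
    c′ : Fin (suc m) → A
    c′ zero    = z
    c′ (suc v) = c v
    c′∈L : ∀ v → c′ v ∈ₗ L v
    c′∈L zero    = z∈L₀
    c′∈L (suc v) = c∈L v
    c′-inj : ∀ u v → c′ u ≡ c′ v → u ≡ v
    c′-inj zero    zero    _  = refl
    c′-inj zero    (suc v) eq = contradiction (subst (_∈ₗ _) (sym eq) (Memₚ.∈-tabulate⁺ v)) z-new
    c′-inj (suc u) zero    eq = contradiction (subst (_∈ₗ _) eq (Memₚ.∈-tabulate⁺ u)) z-new
    c′-inj (suc u) (suc v) eq = cong suc (c-inj eq)

map⁺-injectiveOn : ∀ {A B : Set} {f : A → B} {P : Pred A 0ℓ} {xs} → All P xs →
  (∀ {x y} → P x → P y → f x ≡ f y → x ≡ y) → Unique xs → Unique (map f xs)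
map⁺-injectiveOn {xs = []}     _             _   []              = []
map⁺-injectiveOn {xs = x ∷ xs} (px All.∷ pxs) inj (x∉xs ∷ unique) =
  Allₚ.map⁺ (All.zipWith (λ (x≢y , py) fx≡fy → x≢y (inj px py fx≡fy)) (x∉xs , pxs))
  ∷ map⁺-injectiveOn pxs inj unique

allColours : ∀ {m} → (Fin m → List ℕ) → List ℕ
allColours {zero}  _ = []
allColours {suc m} L = L zero ++ allColours (L ∘ suc)

∈-allColours : ∀ {m} (L : Fin m → List ℕ) v {x} → x ∈ₗ L v → x ∈ₗ allColours L
∈-allColours L zero    x∈L = Memₚ.∈-++⁺ˡ x∈L
∈-allColours L (suc v) x∈L = Memₚ.∈-++⁺ʳ (L zero) (∈-allColours (L ∘ suc) v x∈L)

length-allColours : ∀ {m k} (L : Fin m → List ℕ) → (∀ v → length (L v) ≡ k) → length (allColours L) ≡ m * k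
length-allColours {zero}  L length-L = refl
length-allColours {suc m} L length-L =
  trans (Listₚ.length-++ (L zero)) (cong₂ ℕ._+_ (length-L zero) (length-allColours (L ∘ suc) (length-L ∘ suc)))

module _ {m k} (L : Fin m → List ℕ) (length-L : ∀ v → length (L v) ≡ k) where
  open MemDec ℕ._≟_ using () renaming (_∈?_ to _∈ₗ?_)

  encode : ℕ → Fin (suc (m * k))
  encode x with x ∈ₗ? allColours L
  ... | yes x∈L = inject₁ (subst Fin (length-allColours L length-L) (index x∈L))
  ... | no _    = fromℕ (m * k)

  encode-injective : ∀ {x y} → x ∈ₗ allColours L → y ∈ₗ allColours L → encode x ≡ encode y → x ≡ y
  encode-injective {x} {y} x∈L y∈L eq with x ∈ₗ? allColours L | y ∈ₗ? allColours L
  ... | no ¬x∈L | _       = contradiction x∈L ¬x∈L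
  ... | yes _   | no ¬y∈L = contradiction y∈L ¬y∈L
  ... | yes p   | yes q   = begin
    x                                    ≡⟨ lookup-index p ⟩
    List.lookup (allColours L) (index p) ≡⟨ cong (List.lookup (allColours L)) same-index ⟩
    List.lookup (allColours L) (index q) ≡⟨ lookup-index q ⟨
    y                                    ∎
    where
    open ≡-Reasoning
    same-index : index p ≡ index q
    same-index = subst-injective (length-allColours L length-L) (Finₚ.inject₁-injective eq)

DecidableEdges : Hypergraph → Set
DecidableEdges H = ∀ S → Dec (Edge H S)

module _ (H : Hypergraph) where

  proper-refine : ∀ {C C′ : Set} (c : Fin (n H) → C) (c′ : Fin (n H) → C′) →
    (∀ {u v} → c′ u ≡ c′ v → c u ≡ c v) → Proper H c → Proper H c′
  proper-refine c c′ refines proper S e with u , v , u∈S , v∈S , cu≢cv ← proper S e =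
    u , v , u∈S , v∈S , cu≢cv ∘ refines

  proper-map⁻ : ∀ {A B : Set} (f : A → B) (xs : Fin (n H) → List A) (c : Fin (n H) → B) →
    (∀ v → c v ∈ₗ map f (xs v)) → Proper H c → ∃ λ c′ → (∀ v → c′ v ∈ₗ xs v) × Proper H c′
  proper-map⁻ f xs c c∈fxs proper = c′ , (λ v → proj₁ (proj₂ (preimage v))) , proper-refine c c′ refines proper
    where
    preimage : ∀ v → ∃ λ x → x ∈ₗ xs v × c v ≡ f x
    preimage v = Memₚ.∈-map⁻ f (c∈fxs v)
    c′ = λ v → proj₁ (preimage v)
    refines : ∀ {u v} → c′ u ≡ c′ v → c u ≡ c v
    refines {u} {v} eq = trans (proj₂ (proj₂ (preimage u))) (trans (cong f eq) (sym (proj₂ (proj₂ (preimage v)))))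

  proper? : DecidableEdges H → ∀ {C : Set} → DecidableEquality C → (c : Fin (n H) → C) → Dec (Proper H c)
  proper? edge? _≟_ c = search-∀ anySubset? λ S → edge? S →-dec
    Finₚ.any? λ u → Finₚ.any? λ v → (u ∈? S) ×-dec (v ∈? S) ×-dec ¬? (c u ≟ c v)

  lColorable? : DecidableEdges H → ∀ {k} (L : ListAssignment H k) → Dec (LColorable H L)
  lColorable? edge? {k} (L , wf) =
    map′ fromChoice toChoice (searchable-Vec Finₚ.any? λ s → proper? edge? ℕ._≟_ (pick s))
    where
    pick : Vec (Fin k) (n H) → Fin (n H) → ℕ
    pick s v = List.lookup (L v) (cast (sym (proj₁ (wf v))) (lookup s v))
    fromChoice : ∃ (λ s → Proper H (pick s)) → LColorable H (L , wf)
    fromChoice (s , proper) = pick s , (λ v → Memₚ.∈-lookup _) , proper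
    toChoice : LColorable H (L , wf) → ∃ λ s → Proper H (pick s)
    toChoice (c , c∈L , proper) =
      s , proper-refine c (pick s) (λ {u} {v} eq → trans (sym (pick-s u)) (trans eq (pick-s v))) proper
      where
      s = tabulate (λ v → cast (proj₁ (wf v)) (index (c∈L v)))
      pick-s : ∀ v → pick s v ≡ c v
      pick-s v = begin
        List.lookup (L v) (cast _ (lookup s v))
          ≡⟨ cong (List.lookup (L v) ∘ cast _) (Vecₚ.lookup∘tabulate _ v) ⟩
        List.lookup (L v) (cast _ (cast (proj₁ (wf v)) (index (c∈L v))))
          ≡⟨ cong (List.lookup (L v)) (Finₚ.cast-involutive (sym (proj₁ (wf v))) (proj₁ (wf v)) (index (c∈L v))) ⟩
        List.lookup (L v) (index (c∈L v))
          ≡⟨ lookup-index (c∈L v) ⟨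
        c v
          ∎
        where open ≡-Reasoning

  choosable-mono : ∀ {j k} → j ≤ k → Choosable H j → Choosable H k
  choosable-mono {j} j≤k choosable (L , wf) = untruncate (choosable truncated)
    where
    truncated : ListAssignment H j
    truncated = take j ∘ L , λ v →
      trans (Listₚ.length-take j (L v)) (trans (cong (j ℕ.⊓_) (proj₁ (wf v))) (m≤n⇒m⊓n≡m j≤k)) ,
      Uniqueₚ.take⁺ j (proj₂ (wf v))
    untruncate : LColorable H truncated → LColorable H (L , wf)
    untruncate (c , c∈L , proper) = c , (λ v → Any-resp-⊆ (take-⊆ j (L v)) (c∈L v)) , proper

  choosable-order : Proper H (λ v → v) → Choosable H (n H)
  choosable-order proper (L , wf)
    with c , c∈L , injective ←
           distinct-representatives ℕ._≟_ L (λ v → ≤-reflexive (sym (proj₁ (wf v)))) (proj₂ ∘ wf)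
    = c , c∈L , proper-refine (λ v → v) c injective proper

  -- Via `encode`, every k-list assignment is an injective relabelling of one with colours in
  -- Fin (n H * k + 1) (positions in the concatenated lists, plus a spare code), so choosability
  -- is decided by a finite search.
  CodedAssignment : ℕ → Set
  CodedAssignment k = Vec (Vec (Fin (suc (n H * k))) k) (n H)

  decode : ∀ {k} (B : CodedAssignment k) → (∀ v → Unique (toList (lookup B v))) → ListAssignment H k
  decode B unique = (λ v → map toℕ (toList (lookup B v))) , λ v →
    trans (Listₚ.length-map toℕ (toList (lookup B v))) (Vecₚ.length-toList (lookup B v)) ,
    Uniqueₚ.map⁺ Finₚ.toℕ-injective (unique v)

  CodedChoosable : ℕ → Set
  CodedChoosable k = ∀ (B : CodedAssignment k) unique → LColorable H (decode B unique)

  codedChoosable⇒choosable : ∀ {k} → CodedChoosable k → Choosable H k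
  codedChoosable⇒choosable {k} coded (L , wf) = relabel (coded B unique)
    where
    code = encode L (proj₁ ∘ wf)
    row : Fin (n H) → Vec (Fin (suc (n H * k))) k
    row v = Vec.cast (trans (Listₚ.length-map code (L v)) (proj₁ (wf v))) (fromList (map code (L v)))
    B = tabulate row
    toList-B : ∀ v → toList (lookup B v) ≡ map code (L v)
    toList-B v = trans (cong toList (Vecₚ.lookup∘tabulate row v)) (trans (Vecₚ.toList-cast _ _) (Vecₚ.toList∘fromList _))
    unique : ∀ v → Unique (toList (lookup B v))
    unique v = subst Unique (sym (toList-B v))
      (map⁺-injectiveOn (All.tabulate (∈-allColours L v)) (encode-injective L (proj₁ ∘ wf)) (proj₂ (wf v)))
    decoded : ∀ v → proj₁ (decode B unique) v ≡ map (toℕ ∘ code) (L v)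
    decoded v = trans (cong (map toℕ) (toList-B v)) (sym (Listₚ.map-∘ (L v)))
    relabel : LColorable H (decode B unique) → LColorable H (L , wf)
    relabel (c , c∈B , proper) = proper-map⁻ (toℕ ∘ code) L c (λ v → subst (c v ∈ₗ_) (decoded v) (c∈B v)) proper

  codedChoosable? : DecidableEdges H → ∀ k → Dec (CodedChoosable k)
  codedChoosable? edge? k = search-∀ (searchable-Vec (searchable-Vec Finₚ.any?)) coded?
    where
    coded? : (B : CodedAssignment k) → Dec (∀ unique → LColorable H (decode B unique))
    coded? B with Finₚ.all? (λ v → UniqueDec.unique? Finₚ._≟_ (toList (lookup B v)))
    ... | yes unique = map′ (λ colourable _ → colourable) (_$ unique) (lColorable? edge? (decode B unique))
    ... | no ¬unique = yes λ unique → contradiction unique ¬unique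

  choosable? : DecidableEdges H → ∀ k → Dec (Choosable H k)
  choosable? edge? k =
    map′ codedChoosable⇒choosable (λ choosable B unique → choosable (decode B unique)) (codedChoosable? edge? k)

  listChromaticNumber : DecidableEdges H → ∀ {m} → Choosable H m → ∃ (IsListChromaticNumber H)
  listChromaticNumber edge? = least (choosable? edge?)

module CompleteMultipartite-properties (r k p : ℕ) where

  H : Hypergraph
  H = CompleteMultipartite r k p

  part : Fin (k * p) → Fin k
  part = quotient p

  slot : Fin (k * p) → Fin p
  slot = remainder {k} p

  part-combine : ∀ i j → part (combine i j) ≡ i
  part-combine i j = cong proj₁ (Finₚ.remQuot-combine {k} {p} i j)

  slot-combine : ∀ i j → slot (combine i j) ≡ j
  slot-combine i j = cong proj₂ (Finₚ.remQuot-combine {k} {p} i j)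

  edge? : DecidableEdges H
  edge? S = (∣ S ∣ ℕ.≟ r) ×-dec ¬? (Finₚ.any? λ i → Finₚ.all? λ v → (v ∈? S) →-dec (part v Fin.≟ i))

  part-proper : 1 ≤ r → Proper H part
  part-proper 1≤r S (∣S∣≡r , ¬inOnePart) with nonempty? S
  ... | no empty =
    contradiction (trans (sym ∣S∣≡r) (trans (cong ∣_∣ (Empty-unique empty)) (∣⊥∣≡0 (k * p)))) (>⇒≢ 1≤r)
  ... | yes (u , u∈S) with Finₚ.any? (λ v → (v ∈? S) ×-dec ¬? (part v Fin.≟ part u))
  ...   | yes (v , v∈S , parts-differ) = v , u , v∈S , u∈S , parts-differ
  ...   | no none = contradiction (part u , inPart-u) ¬inOnePart
    where
    inPart-u : ∀ v → v ∈ S → part v ≡ part u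
    inPart-u v v∈S = decidable-stable (part v Fin.≟ part u) λ parts-differ → none (v , v∈S , parts-differ)

  part-size : ∀ i → count (λ v → part v Fin.≟ i) ≡ p
  part-size i = begin
    count (λ v → part v Fin.≟ i)
      ≡⟨ sum-combine k _ ⟩
    ∑[ l < k ] ∑[ j < p ] indicator (part (combine l j) Fin.≟ i)
      ≡⟨ sum-cong-≗ (λ l → sum-cong-≗ λ j → cong (indicator ∘ (Fin._≟ i)) (part-combine l j)) ⟩
    ∑[ l < k ] ∑[ j < p ] indicator (l Fin.≟ i)
      ≡⟨ sum-cong-≗ (λ l → sum-const p (indicator (l Fin.≟ i))) ⟩
    ∑[ l < k ] (p * indicator (l Fin.≟ i))
      ≡⟨ *-distribˡ-sum p (λ l → indicator (l Fin.≟ i)) ⟨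
    p * count (Fin._≟ i)
      ≡⟨ cong (p *_) (count-singleton i) ⟩
    p * 1
      ≡⟨ *-identityʳ p ⟩
    p ∎
    where open ≡-Reasoning

  classSize : ∀ {m} → (Fin (k * p) → Fin m) → Fin m → ℕ
  classSize c x = count (λ v → c v Fin.≟ x)

  class-in-part-≤ : ∀ {m} {c : Fin (k * p) → Fin m} {x i} → (∀ {v} → c v ≡ x → part v ≡ i) → classSize c x ≤ p
  class-in-part-≤ {c = c} {x} {i} inPart =
    subst (classSize c x ≤_) (part-size i) (count-mono (λ v → c v Fin.≟ x) (λ v → part v Fin.≟ i) inPart)

  module _ (2≤r : 2 ≤ r) {m} {c : Fin (k * p) → Fin m} (proper : Proper H c) where

    no-large-spanning-class : ∀ {x a b} → c a ≡ x → c b ≡ x → part a ≢ part b → ¬ r ≤ classSize c x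
    no-large-spanning-class {x} {a} {b} ca≡x cb≡x parts-differ r≤size
      with S , ab∈S , S⊆class , ∣S∣≡r ←
             subset-between (λ v → (v Fin.≟ a) ⊎-dec (v Fin.≟ b)) (λ v → c v Fin.≟ x)
               (λ { (inj₁ refl) → ca≡x ; (inj₂ refl) → cb≡x }) (≤-trans (count-pair-≤ a b) 2≤r) r≤size
      with u , v , u∈S , v∈S , cu≢cv ← proper S (∣S∣≡r , λ (i , S⊆i) →
             parts-differ (trans (S⊆i a (ab∈S (inj₁ refl))) (sym (S⊆i b (ab∈S (inj₂ refl))))))
      = cu≢cv (trans (S⊆class u∈S) (sym (S⊆class v∈S)))

    class-small-or-in-part : ∀ x → classSize c x < r ⊎ ∃ λ i → ∀ {v} → c v ≡ x → part v ≡ i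
    class-small-or-in-part x with Finₚ.any? (λ a → c a Fin.≟ x)
    ... | no empty =
      inj₁ (subst (_< r) (sym (count-empty _ λ v cv≡x → empty (v , cv≡x))) (≤-trans (s≤s z≤n) 2≤r))
    ... | yes (a , ca≡x) with Finₚ.any? (λ b → (c b Fin.≟ x) ×-dec ¬? (part b Fin.≟ part a))
    ...   | yes (b , cb≡x , parts-differ) = inj₁ (≰⇒> (no-large-spanning-class cb≡x ca≡x parts-differ))
    ...   | no none = inj₂ (part a , λ {v} cv≡x →
                        decidable-stable (part v Fin.≟ part a) λ parts-differ → none (v , cv≡x , parts-differ))

  uncolourable : 2 ≤ r → r ≤ suc p → ∀ j → j < k → ¬ Colorable H j
  uncolourable 2≤r r≤1+p j j<k (c , proper) = <⇒≱ j<k (*-cancelʳ-≤ k j p {{ℕ.>-nonZero 1≤p}} kp≤jp)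
    where
    1≤p : 1 ≤ p
    1≤p = s≤s⁻¹ (≤-trans 2≤r r≤1+p)
    class≤p : ∀ x → classSize c x ≤ p
    class≤p x with class-small-or-in-part 2≤r proper x
    ... | inj₁ small        = s≤s⁻¹ (≤-trans small r≤1+p)
    ... | inj₂ (_ , inPart) = class-in-part-≤ inPart
    kp≤jp : k * p ≤ j * p
    kp≤jp = begin
      k * p                    ≡⟨ ∑-count-fibres c ⟨
      ∑[ x < j ] classSize c x ≤⟨ sum-mono-≤ class≤p ⟩
      ∑[ x < j ] p             ≡⟨ sum-const j p ⟩
      j * p                    ∎
      where open ≤-Reasoning

module SlotAvoiding (r k : ℕ) (2≤r : 2 ≤ r) (r≤k : r ≤ k) where
  open CompleteMultipartite-properties r k (suc r)

  module _ {c : Fin (k * suc r) → Fin (suc r)} (proper : Proper H c) (avoids-slot : ∀ v → c v ≢ slot v) where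

    class≤r : ∀ x → classSize c x ≤ r
    class≤r x with class-small-or-in-part 2≤r proper x
    ... | inj₁ small        = <⇒≤ small
    ... | inj₂ (i , inPart) = s≤s⁻¹ (begin
      suc (classSize c x)              ≡⟨ +-comm 1 (classSize c x) ⟩
      classSize c x + 1                ≡⟨ cong (classSize c x +_) (count-singleton w) ⟨
      classSize c x + count (Fin._≟ w) ≤⟨ count-disjoint-≤ (λ v → c v Fin.≟ x) (Fin._≟ w) (λ v → part v Fin.≟ i)
                                            w∉class class+w⊆part ⟩
      count (λ v → part v Fin.≟ i)     ≡⟨ part-size i ⟩
      suc r                            ∎)
      where
      open ≤-Reasoning
      w = combine i x
      w∉class : ∀ {v} → c v ≡ x → v ≢ w
      w∉class cv≡x refl = avoids-slot w (trans cv≡x (sym (slot-combine i x)))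
      class+w⊆part : ∀ {v} → c v ≡ x ⊎ v ≡ w → part v ≡ i
      class+w⊆part (inj₁ cv≡x) = inPart cv≡x
      class+w⊆part (inj₂ refl) = part-combine i x

    class≥r : ∀ x → r ≤ classSize c x
    class≥r x = ≮⇒≥ λ small → <-irrefl refl (begin-strict
      suc r * r                    ≡⟨ *-comm (suc r) r ⟩
      r * suc r                    ≤⟨ *-monoˡ-≤ (suc r) r≤k ⟩
      k * suc r                    ≡⟨ ∑-count-fibres c ⟨
      ∑[ y < suc r ] classSize c y <⟨ sum-mono-< class≤r small ⟩
      ∑[ y < suc r ] r             ≡⟨ sum-const (suc r) r ⟩
      suc r * r                    ∎)
      where open ≤-Reasoning

    classes-within-parts : ∀ {u v} → c u ≡ c v → part u ≡ part v
    classes-within-parts {u} cu≡cv with class-small-or-in-part 2≤r proper (c u)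
    ... | inj₁ small        = contradiction (class≥r (c u)) (<⇒≱ small)
    ... | inj₂ (i , inPart) = trans (inPart refl) (sym (inPart (sym cu≡cv)))

    no-proper-colouring : ⊥
    no-proper-colouring = <⇒≱ 2≤r (+-cancelˡ-≤ r r 1 (begin
      r + r                                 ≤⟨ +-mono-≤ (class≥r (c a)) (class≥r (c b)) ⟩
      classSize c (c a) + classSize c (c b) ≤⟨ count-disjoint-≤ (λ v → c v Fin.≟ c a) (λ v → c v Fin.≟ c b)
                                                 (λ v → part v Fin.≟ i₀) disjoint classes⊆part ⟩
      count (λ v → part v Fin.≟ i₀)         ≡⟨ part-size i₀ ⟩
      suc r                                 ≡⟨ +-comm 1 r ⟩
      r + 1                                 ∎))
      where
      open ≤-Reasoning
      i₀ : Fin k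
      i₀ = fromℕ< (≤-trans (s≤s z≤n) (≤-trans 2≤r r≤k))
      a b : Fin (k * suc r)
      a = combine i₀ zero
      b = combine i₀ (c a)
      cb≢ca : c b ≢ c a
      cb≢ca cb≡ca = avoids-slot b (trans cb≡ca (sym (slot-combine i₀ (c a))))
      disjoint : ∀ {v} → c v ≡ c a → c v ≢ c b
      disjoint cv≡ca cv≡cb = cb≢ca (trans (sym cv≡cb) cv≡ca)
      classes⊆part : ∀ {v} → c v ≡ c a ⊎ c v ≡ c b → part v ≡ i₀
      classes⊆part (inj₁ cv≡ca) = trans (classes-within-parts cv≡ca) (part-combine i₀ zero)
      classes⊆part (inj₂ cv≡cb) = trans (classes-within-parts cv≡cb) (part-combine i₀ (c a))

  slotAvoidingColours : Fin (k * suc r) → List (Fin (suc r))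
  slotAvoidingColours v = List.tabulate (punchIn (slot v))

  slotAvoiding : ListAssignment H r
  slotAvoiding = map toℕ ∘ slotAvoidingColours , λ v →
    trans (Listₚ.length-map toℕ (slotAvoidingColours v)) (Listₚ.length-tabulate (punchIn (slot v))) ,
    Uniqueₚ.map⁺ Finₚ.toℕ-injective (Uniqueₚ.tabulate⁺ (Finₚ.punchIn-injective (slot v) _ _))

  slotAvoiding-uncolourable : ¬ LColorable H slotAvoiding
  slotAvoiding-uncolourable (c , c∈L , proper)
    with c′ , c′∈L , proper′ ← proper-map⁻ H toℕ slotAvoidingColours c c∈L proper
    = no-proper-colouring proper′ λ v → avoids-slot v (Memₚ.∈-tabulate⁻ (c′∈L v))
    where
    avoids-slot : ∀ v → ∃ (λ y → c′ v ≡ punchIn (slot v) y) → c′ v ≢ slot v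
    avoids-slot v (y , c′v≡) c′v≡slot = Finₚ.punchInᵢ≢i (slot v) y (trans (sym c′v≡) c′v≡slot)

  not-choosable : ∀ {j} → j ≤ r → ¬ Choosable H j
  not-choosable j≤r choosable = slotAvoiding-uncolourable (choosable-mono H j≤r choosable slotAvoiding)

theorem3p2 : (r : ℕ) → 2 ≤ r →
    IsChromaticNumber (K[r+1*r] r) r ×
    Σ ℕ (λ l → IsListChromaticNumber (K[r+1*r] r) l × r < l)
theorem3p2 r 2≤r =
  (colorable , uncolourable 2≤r (≤-trans (n≤1+n r) (n≤1+n (suc r)))) ,
  exceeds-r (listChromaticNumber H edge? (choosable-order H vertices-proper))
  where
  open CompleteMultipartite-properties r r (suc r)
  open SlotAvoiding r r 2≤r ≤-refl
  parts-proper : Proper H part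
  parts-proper = part-proper (≤-trans (s≤s z≤n) 2≤r)
  colorable : Colorable H r
  colorable = part , parts-proper
  vertices-proper : Proper H (λ v → v)
  vertices-proper = proper-refine H part (λ v → v) (cong part) parts-proper
  exceeds-r : ∃ (IsListChromaticNumber H) → Σ ℕ λ l → IsListChromaticNumber H l × r < l
  exceeds-r (l , choosable , minimal) = l , (choosable , minimal) , ≰⇒> λ l≤r → not-choosable l≤r choosable
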